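{- Let $s\ge1$ and $k\ge 0$ be integers and let $F_k(x)=\sum_{n\ge0}\binom{n}{k}_{[s]}x^n$ (as a formal power series). Then $$F_k(x)=(1+x+x^2+\cdots+x^{s-1})^{k}\,\frac{x^{k}}{(1-x)^{k+1}}.$$
   Context: For integers $n,k$ with $0\le k\le n$, $\binom{n}{k}_{[s]}$ is the number of lattice paths from $(0,0)$ to $(n,k)$ using steps from $\{(1,0),(1,1),(2,1),\ldots,(s,1)\}$; for $k<0$ or $k>n$ it is $0$. -}

module Defs where

open import Data.Nat using (ℕ; zero; suc; _+_; _*_; _∸_; _<ᵇ_)
open import Data.Nat.Properties using (_≟_)
open import Data.Bool using (Bool; true; false; if_then_else_)
open import Data.Product using (_×_; _,_)
open import Data.Product.Properties using (≡-dec)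
open import Data.List using (List; []; _∷_; map; concatMap; upTo; length; foldr)
open import Relation.Nullary using (does)

Step : Set
Step = ℕ × ℕ

steps : ℕ → List Step
steps s = (1 , 0) ∷ map (λ j → (suc j , 1)) (upTo s)

words : {A : Set} → List A → ℕ → List (List A)
words xs zero    = [] ∷ []
words xs (suc m) = concatMap (λ a → map (a ∷_) (words xs m)) xs

endpoint : List Step → ℕ × ℕ
endpoint = foldr (λ { (a , b) (c , d) → (a + c , b + d) }) (0 , 0)

countWhere : {A : Set} → (A → Bool) → List A → ℕ
countWhere p []       = 0
countWhere p (x ∷ xs) = if p x then suc (countWhere p xs) else countWhere p xs

-- binom s n k : number of lattice paths from (0,0) to (n,k) with steps in
-- (steps s).  Every step has x-component ≥ 1, so such a path has at most n
-- steps; we enumerate all step sequences of length 0..n and count those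
-- ending at (n,k).  (Automatically 0 when k > n.)
binom : ℕ → ℕ → ℕ → ℕ
binom s n k =
  countWhere (λ w → does (≡-dec _≟_ _≟_ (endpoint w) (n , k)))
             (concatMap (words (steps s)) (upTo (suc n)))

Series : Set
Series = ℕ → ℕ

sumBelow : ℕ → (ℕ → ℕ) → ℕ
sumBelow zero    f = 0
sumBelow (suc m) f = sumBelow m f + f m

_⊛_ : Series → Series → Series
(f ⊛ g) n = sumBelow (suc n) (λ i → f i * g (n ∸ i))

one : Series
one zero    = 1
one (suc n) = 0

_^ˢ_ : Series → ℕ → Series
f ^ˢ zero  = one
f ^ˢ suc k = f ⊛ (f ^ˢ k)

X : Series
X 1 = 1
X _ = 0

geomPoly : ℕ → Series
geomPoly s n = if n <ᵇ s then 1 else 0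

invOneMinusX : Series
invOneMinusX _ = 1

F : ℕ → ℕ → Series
F s k n = binom s n k

-- Splitting a path by its first step gives, for B(n,k) = binom s n k,
--   B(n,0) = 1,   B(n,k+1) = B(n-1,k+1) + Σ_{1≤j≤s} B(n-j,k),
-- that is, F₀ = 1/(1-x) and (1-x) F_{k+1} = (x + ⋯ + xˢ) F_k.  The right-hand
-- side of the theorem satisfies the same recurrence, which determines the
-- family uniquely.  Since B counts paths of every length m ≤ n, the recurrence
-- is first established for paths of a fixed length m and then summed over m;
-- this uses that a path of length m ends at an x-coordinate ≥ m.
module Submission where

open import Defs
open import Algebra.Bundles using (CommutativeMonoid)
import Algebra.Properties.CommutativeSemigroup as CommutativeSemigroupProperties
import Algebra.Solver.CommutativeMonoid as CommutativeMonoidSolver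
open import Data.Bool using (Bool; true; false)
open import Data.Empty using (⊥-elim)
open import Data.List using (List; []; _∷_; map; concatMap; applyUpTo; upTo; _++_)
open import Data.List.Properties using (map-applyUpTo)
open import Data.Nat
open import Data.Nat.Properties
open import Data.Product using (_×_; _,_; proj₁; proj₂)
open import Data.Product.Properties using (≡-dec; ,-injectiveˡ; ,-injectiveʳ)
open import Data.Sum using (_⊎_; inj₁; inj₂; [_,_]′)
open import Function using (_∘_)
open import Relation.Nullary using (does; yes; no)
open import Relation.Nullary.Decidable using (dec-true; dec-false)
open import Relation.Binary.PropositionalEquality
open ≡-Reasoning

-- Finite sums

sumBelow-cong : ∀ m {f g : ℕ → ℕ} → (∀ i → i < m → f i ≡ g i) →
                sumBelow m f ≡ sumBelow m g
sumBelow-cong zero    eq = refl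
sumBelow-cong (suc m) eq =
  cong₂ _+_ (sumBelow-cong m (λ i i<m → eq i (m<n⇒m<1+n i<m))) (eq m ≤-refl)

sumBelow-ext : ∀ m {f g : ℕ → ℕ} → f ≗ g → sumBelow m f ≡ sumBelow m g
sumBelow-ext m eq = sumBelow-cong m (λ i _ → eq i)

sumBelow-zero : ∀ m {f : ℕ → ℕ} → (∀ i → f i ≡ 0) → sumBelow m f ≡ 0
sumBelow-zero zero    _  = refl
sumBelow-zero (suc m) eq = cong₂ _+_ (sumBelow-zero m eq) (eq m)

sumBelow-unfoldˡ : ∀ m (f : ℕ → ℕ) → sumBelow (suc m) f ≡ f 0 + sumBelow m (f ∘ suc)
sumBelow-unfoldˡ zero    f = sym (+-identityʳ (f 0))
sumBelow-unfoldˡ (suc m) f = begin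
  sumBelow (suc m) f + f (suc m)          ≡⟨ cong (_+ f (suc m)) (sumBelow-unfoldˡ m f) ⟩
  f 0 + sumBelow m (f ∘ suc) + f (suc m)  ≡⟨ +-assoc (f 0) _ _ ⟩
  f 0 + sumBelow (suc m) (f ∘ suc)        ∎

sumBelow-distrib-+ : ∀ m (f g : ℕ → ℕ) →
                     sumBelow m (λ i → f i + g i) ≡ sumBelow m f + sumBelow m g
sumBelow-distrib-+ zero    f g = refl
sumBelow-distrib-+ (suc m) f g =
  trans (cong (_+ (f m + g m)) (sumBelow-distrib-+ m f g))
        (interchange (sumBelow m f) (sumBelow m g) (f m) (g m))
  where open CommutativeSemigroupProperties +-commutativeSemigroup using (interchange)

sumBelow-*ˡ : ∀ m c (f : ℕ → ℕ) → sumBelow m (λ i → c * f i) ≡ c * sumBelow m f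
sumBelow-*ˡ zero    c f = sym (*-zeroʳ c)
sumBelow-*ˡ (suc m) c f =
  trans (cong (_+ c * f m) (sumBelow-*ˡ m c f)) (sym (*-distribˡ-+ c (sumBelow m f) (f m)))

sumBelow-swap : ∀ m n (f : ℕ → ℕ → ℕ) →
  sumBelow m (λ i → sumBelow n (f i)) ≡ sumBelow n (λ j → sumBelow m (λ i → f i j))
sumBelow-swap zero    n f = sym (sumBelow-zero n (λ _ → refl))
sumBelow-swap (suc m) n f =
  trans (cong (_+ sumBelow n (f m)) (sumBelow-swap m n f))
        (sym (sumBelow-distrib-+ n _ (f m)))

sumBelow-reverse : ∀ m (f : ℕ → ℕ) → sumBelow m (λ i → f (m ∸ suc i)) ≡ sumBelow m f
sumBelow-reverse zero    f = refl
sumBelow-reverse (suc m) f = begin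
  sumBelow (suc m) (λ i → f (m ∸ i))      ≡⟨ sumBelow-unfoldˡ m _ ⟩
  f m + sumBelow m (λ i → f (m ∸ suc i))  ≡⟨ cong (f m +_) (sumBelow-reverse m f) ⟩
  f m + sumBelow m f                      ≡⟨ +-comm (f m) _ ⟩
  sumBelow m f + f m                      ∎

sumBelow-truncate : ∀ {a b} (f : ℕ → ℕ) → b ≤ a → (∀ i → b ≤ i → i < a → f i ≡ 0) →
                    sumBelow a f ≡ sumBelow b f
sumBelow-truncate f b≤a vanish with m≤n⇒m<n∨m≡n b≤a
... | inj₂ refl = refl
sumBelow-truncate {suc a} {b} f _ vanish | inj₁ b<1+a = begin
  sumBelow a f + f a  ≡⟨ cong₂ _+_ (sumBelow-truncate f (≤-pred b<1+a) vanish′)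
                                   (vanish a (≤-pred b<1+a) ≤-refl) ⟩
  sumBelow b f + 0    ≡⟨ +-identityʳ _ ⟩
  sumBelow b f        ∎
  where vanish′ = λ i b≤i i<a → vanish i b≤i (m<n⇒m<1+n i<a)

-- Formal power series under the Cauchy product

tail : Series → Series
tail f i = f (suc i)

shift : Series → Series
shift f zero    = 0
shift f (suc n) = f n

shift-cong : ∀ {f g : Series} → f ≗ g → shift f ≗ shift g
shift-cong eq zero    = refl
shift-cong eq (suc n) = eq n

⊛-cong : ∀ {f f′ g g′ : Series} → f ≗ f′ → g ≗ g′ → f ⊛ g ≗ f′ ⊛ g′
⊛-cong f≗f′ g≗g′ n = sumBelow-ext (suc n) (λ i → cong₂ _*_ (f≗f′ i) (g≗g′ (n ∸ i)))

⊛-unfoldˡ : ∀ (f g : Series) n → (f ⊛ g) (suc n) ≡ f 0 * g (suc n) + (tail f ⊛ g) n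
⊛-unfoldˡ f g n = sumBelow-unfoldˡ (suc n) _

⊛-distribʳ-+ : ∀ (f g h : Series) n →
               ((λ i → f i + g i) ⊛ h) n ≡ (f ⊛ h) n + (g ⊛ h) n
⊛-distribʳ-+ f g h n =
  trans (sumBelow-ext (suc n) (λ i → *-distribʳ-+ (h (n ∸ i)) (f i) (g i)))
        (sumBelow-distrib-+ (suc n) _ _)

⊛-*ˡ : ∀ c (f h : Series) n → ((λ i → c * f i) ⊛ h) n ≡ c * (f ⊛ h) n
⊛-*ˡ c f h n =
  trans (sumBelow-ext (suc n) (λ i → *-assoc c (f i) (h (n ∸ i)))) (sumBelow-*ˡ (suc n) c _)

⊛-assoc : ∀ (f g h : Series) → (f ⊛ g) ⊛ h ≗ f ⊛ (g ⊛ h)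
⊛-assoc f g h zero    = *-assoc (f 0) (g 0) (h 0)
⊛-assoc f g h (suc n) = begin
  ((f ⊛ g) ⊛ h) (suc n)
    ≡⟨ ⊛-unfoldˡ (f ⊛ g) h n ⟩
  f 0 * g 0 * h (suc n) + (tail (f ⊛ g) ⊛ h) n
    ≡⟨ cong (f 0 * g 0 * h (suc n) +_) (⊛-cong {g = h} {g′ = h} (⊛-unfoldˡ f g) (λ _ → refl) n) ⟩
  f 0 * g 0 * h (suc n) + ((λ i → f 0 * tail g i + (tail f ⊛ g) i) ⊛ h) n
    ≡⟨ cong (f 0 * g 0 * h (suc n) +_) (⊛-distribʳ-+ (λ i → f 0 * tail g i) (tail f ⊛ g) h n) ⟩
  f 0 * g 0 * h (suc n) + (((λ i → f 0 * tail g i) ⊛ h) n + ((tail f ⊛ g) ⊛ h) n)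
    ≡⟨ cong₂ (λ a b → f 0 * g 0 * h (suc n) + (a + b))
             (⊛-*ˡ (f 0) (tail g) h n) (⊛-assoc (tail f) g h n) ⟩
  f 0 * g 0 * h (suc n) + (f 0 * (tail g ⊛ h) n + (tail f ⊛ (g ⊛ h)) n)
    ≡⟨ sym (+-assoc (f 0 * g 0 * h (suc n)) _ _) ⟩
  f 0 * g 0 * h (suc n) + f 0 * (tail g ⊛ h) n + (tail f ⊛ (g ⊛ h)) n
    ≡⟨ cong (_+ (tail f ⊛ (g ⊛ h)) n) factor ⟩
  f 0 * (g 0 * h (suc n) + (tail g ⊛ h) n) + (tail f ⊛ (g ⊛ h)) n
    ≡⟨ cong (λ z → f 0 * z + (tail f ⊛ (g ⊛ h)) n) (sym (⊛-unfoldˡ g h n)) ⟩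
  f 0 * (g ⊛ h) (suc n) + (tail f ⊛ (g ⊛ h)) n
    ≡⟨ sym (⊛-unfoldˡ f (g ⊛ h) n) ⟩
  (f ⊛ (g ⊛ h)) (suc n) ∎
  where
  factor : f 0 * g 0 * h (suc n) + f 0 * (tail g ⊛ h) n ≡ f 0 * (g 0 * h (suc n) + (tail g ⊛ h) n)
  factor = trans (cong (_+ f 0 * (tail g ⊛ h) n) (*-assoc (f 0) (g 0) (h (suc n))))
                 (sym (*-distribˡ-+ (f 0) _ _))

⊛-comm : ∀ (f g : Series) → f ⊛ g ≗ g ⊛ f
⊛-comm f g n = begin
  sumBelow (suc n) (λ i → f i * g (n ∸ i))
    ≡⟨ sym (sumBelow-reverse (suc n) _) ⟩
  sumBelow (suc n) (λ i → f (n ∸ i) * g (n ∸ (n ∸ i)))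
    ≡⟨ sumBelow-cong (suc n) (λ i i≤n → trans (*-comm (f (n ∸ i)) _)
                                             (cong (λ j → g j * f (n ∸ i)) (m∸[m∸n]≡n (≤-pred i≤n)))) ⟩
  sumBelow (suc n) (λ i → g i * f (n ∸ i)) ∎

⊛-identityˡ : ∀ (f : Series) → one ⊛ f ≗ f
⊛-identityˡ f zero    = +-identityʳ (f 0)
⊛-identityˡ f (suc n) = begin
  (one ⊛ f) (suc n)                 ≡⟨ ⊛-unfoldˡ one f n ⟩
  f (suc n) + 0 + (tail one ⊛ f) n  ≡⟨ cong (f (suc n) + 0 +_) (sumBelow-zero (suc n) (λ _ → refl)) ⟩
  f (suc n) + 0 + 0                 ≡⟨ trans (+-identityʳ _) (+-identityʳ _) ⟩
  f (suc n)                         ∎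

⊛-identityʳ : ∀ (f : Series) → f ⊛ one ≗ f
⊛-identityʳ f n = trans (⊛-comm f one n) (⊛-identityˡ f n)

⊛-commutativeMonoid : CommutativeMonoid _ _
⊛-commutativeMonoid = record
  { Carrier             = Series
  ; _≈_                 = _≗_
  ; _∙_                 = _⊛_
  ; ε                   = one
  ; isCommutativeMonoid = record
    { isMonoid = record
      { isSemigroup = record
        { isMagma = record
          { isEquivalence = record { refl = λ _ → refl
                                   ; sym = λ eq n → sym (eq n)
                                   ; trans = λ eq eq′ n → trans (eq n) (eq′ n) }
          ; ∙-cong        = ⊛-cong
          }
        ; assoc = ⊛-assoc
        }
      ; identity = ⊛-identityˡ , ⊛-identityʳ
      }
    ; comm = ⊛-comm
    }
  }

X-⊛ : ∀ (f : Series) → X ⊛ f ≗ shift f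
X-⊛ f zero    = refl
X-⊛ f (suc n) = trans (⊛-unfoldˡ X f n) (trans (⊛-cong {g = f} {g′ = f} tail-X (λ _ → refl) n) (⊛-identityˡ f n))
  where
  tail-X : tail X ≗ one
  tail-X zero    = refl
  tail-X (suc _) = refl

invOneMinusX-⊛ : ∀ (g : Series) n → (invOneMinusX ⊛ g) n ≡ shift (invOneMinusX ⊛ g) n + g n
invOneMinusX-⊛ g zero    = +-identityʳ (g 0)
invOneMinusX-⊛ g (suc n) = begin
  (invOneMinusX ⊛ g) (suc n)            ≡⟨ ⊛-comm invOneMinusX g (suc n) ⟩
  (g ⊛ invOneMinusX) n + g (suc n) * 1  ≡⟨ cong₂ _+_ (⊛-comm g invOneMinusX n) (*-identityʳ (g (suc n))) ⟩
  (invOneMinusX ⊛ g) n + g (suc n)      ∎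

geomPoly-*-< : ∀ {s i} x → i < s → geomPoly s i * x ≡ x
geomPoly-*-< {s} {i} x i<s with i <ᵇ s | <⇒<ᵇ i<s
... | true | _ = +-identityʳ x

geomPoly-*-≥ : ∀ {s i} x → s ≤ i → geomPoly s i * x ≡ 0
geomPoly-*-≥ {s} {i} x s≤i with i <ᵇ s | <ᵇ⇒< i s
... | false | _   = refl
... | true  | i<s = ⊥-elim (<⇒≱ (i<s _) s≤i)

-- The series (x + x² + ⋯ + xˢ)·h; for j > n the term is shift h 0 = 0.
shiftSum : ℕ → Series → Series
shiftSum s h n = sumBelow s (λ j → shift h (n ∸ j))

shiftSum-cong : ∀ s {g h : Series} → g ≗ h → shiftSum s g ≗ shiftSum s h
shiftSum-cong s eq n = sumBelow-ext s (λ j → shift-cong eq (n ∸ j))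

geomPoly-⊛-shift : ∀ s (h : Series) → geomPoly s ⊛ shift h ≗ shiftSum s h
geomPoly-⊛-shift s h n with ≤-total s (suc n)
... | inj₁ s≤1+n = begin
  sumBelow (suc n) (λ i → geomPoly s i * shift h (n ∸ i))
    ≡⟨ sumBelow-truncate _ s≤1+n (λ i s≤i _ → geomPoly-*-≥ _ s≤i) ⟩
  sumBelow s (λ i → geomPoly s i * shift h (n ∸ i))
    ≡⟨ sumBelow-cong s (λ i i<s → geomPoly-*-< _ i<s) ⟩
  shiftSum s h n ∎
... | inj₂ 1+n≤s = begin
  sumBelow (suc n) (λ i → geomPoly s i * shift h (n ∸ i))
    ≡⟨ sumBelow-cong (suc n) (λ i i≤n → geomPoly-*-< _ (<-≤-trans i≤n 1+n≤s)) ⟩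
  sumBelow (suc n) (λ j → shift h (n ∸ j))
    ≡⟨ sym (sumBelow-truncate _ 1+n≤s (λ j n<j _ → cong (shift h) (m≤n⇒m∸n≡0 (<⇒≤ n<j)))) ⟩
  shiftSum s h n ∎

-- The recurrence and the closed form

record Recurrence (s : ℕ) (G : ℕ → Series) : Set where
  field
    base : ∀ n → G 0 n ≡ 1
    step : ∀ k n → G (suc k) n ≡ shift (G (suc k)) n + shiftSum s (G k) n

open Recurrence

recurrence-unique : ∀ {s G H} → Recurrence s G → Recurrence s H → ∀ k → G k ≗ H k
recurrence-unique rG rH zero n = trans (base rG n) (sym (base rH n))
recurrence-unique {s} {G} {H} rG rH (suc k) zero = begin
  G (suc k) 0         ≡⟨ step rG k 0 ⟩
  shiftSum s (G k) 0  ≡⟨ shiftSum-cong s (recurrence-unique rG rH k) 0 ⟩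
  shiftSum s (H k) 0  ≡⟨ sym (step rH k 0) ⟩
  H (suc k) 0         ∎
recurrence-unique {s} {G} {H} rG rH (suc k) (suc n) = begin
  G (suc k) (suc n)                           ≡⟨ step rG k (suc n) ⟩
  G (suc k) n + shiftSum s (G k) (suc n)      ≡⟨ cong₂ _+_ (recurrence-unique rG rH (suc k) n)
                                                           (shiftSum-cong s (recurrence-unique rG rH k) (suc n)) ⟩
  H (suc k) n + shiftSum s (H k) (suc n)      ≡⟨ sym (step rH k (suc n)) ⟩
  H (suc k) (suc n)                           ∎

closedForm : ℕ → ℕ → Series
closedForm s k = (geomPoly s ^ˢ k) ⊛ ((X ^ˢ k) ⊛ (invOneMinusX ^ˢ suc k))

closedForm-suc : ∀ s k → closedForm s (suc k) ≗ invOneMinusX ⊛ shiftSum s (closedForm s k)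
closedForm-suc s k n = begin
  closedForm s (suc k) n
    ≡⟨ rearrange (geomPoly s) (geomPoly s ^ˢ k) X (X ^ˢ k) invOneMinusX (invOneMinusX ^ˢ suc k) n ⟩
  (invOneMinusX ⊛ (geomPoly s ⊛ (X ⊛ closedForm s k))) n
    ≡⟨ ⊛-cong {f = invOneMinusX} (λ _ → refl) factor n ⟩
  (invOneMinusX ⊛ shiftSum s (closedForm s k)) n ∎
  where
  factor : geomPoly s ⊛ (X ⊛ closedForm s k) ≗ shiftSum s (closedForm s k)
  factor m = trans (⊛-cong {f = geomPoly s} (λ _ → refl) (X-⊛ (closedForm s k)) m)
                   (geomPoly-⊛-shift s (closedForm s k) m)
  open CommutativeMonoidSolver ⊛-commutativeMonoid
  rearrange : ∀ a a′ b b′ c c′ → (a ⊛ a′) ⊛ ((b ⊛ b′) ⊛ (c ⊛ c′)) ≗ c ⊛ (a ⊛ (b ⊛ (a′ ⊛ (b′ ⊛ c′))))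
  rearrange = solve 6 (λ a a′ b b′ c c′ → (a ⊕ a′) ⊕ ((b ⊕ b′) ⊕ (c ⊕ c′))
                                          ⊜ c ⊕ (a ⊕ (b ⊕ (a′ ⊕ (b′ ⊕ c′))))) (λ _ → refl)

closedForm-recurrence : ∀ s → Recurrence s (closedForm s)
base (closedForm-recurrence s) n = begin
  (one ⊛ (one ⊛ (invOneMinusX ⊛ one))) n  ≡⟨ ⊛-identityˡ (one ⊛ (invOneMinusX ⊛ one)) n ⟩
  (one ⊛ (invOneMinusX ⊛ one)) n          ≡⟨ ⊛-identityˡ (invOneMinusX ⊛ one) n ⟩
  (invOneMinusX ⊛ one) n                  ≡⟨ ⊛-identityʳ invOneMinusX n ⟩
  1                                       ∎
step (closedForm-recurrence s) k n = begin
  closedForm s (suc k) n                ≡⟨ closedForm-suc s k n ⟩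
  (invOneMinusX ⊛ g) n                  ≡⟨ invOneMinusX-⊛ g n ⟩
  shift (invOneMinusX ⊛ g) n + g n      ≡⟨ cong (_+ g n) (shift-cong (λ m → sym (closedForm-suc s k m)) n) ⟩
  shift (closedForm s (suc k)) n + g n  ∎
  where g = shiftSum s (closedForm s k)

-- Counting paths

countWhere-++ : ∀ {A : Set} (p : A → Bool) xs ys →
                countWhere p (xs ++ ys) ≡ countWhere p xs + countWhere p ys
countWhere-++ p []       ys = refl
countWhere-++ p (x ∷ xs) ys with p x
... | true  = cong suc (countWhere-++ p xs ys)
... | false = countWhere-++ p xs ys

countWhere-map : ∀ {A B : Set} (p : B → Bool) (f : A → B) xs →
                 countWhere p (map f xs) ≡ countWhere (p ∘ f) xs
countWhere-map p f []       = refl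
countWhere-map p f (x ∷ xs) with p (f x)
... | true  = cong suc (countWhere-map p f xs)
... | false = countWhere-map p f xs

countWhere-cong : ∀ {A : Set} {p q : A → Bool} → p ≗ q → ∀ xs → countWhere p xs ≡ countWhere q xs
countWhere-cong eq []       = refl
countWhere-cong {q = q} eq (x ∷ xs) rewrite eq x with q x
... | true  = cong suc (countWhere-cong eq xs)
... | false = countWhere-cong eq xs

countWhere-none : ∀ {A : Set} {p : A → Bool} → (∀ x → p x ≡ false) → ∀ xs → countWhere p xs ≡ 0
countWhere-none none []       = refl
countWhere-none none (x ∷ xs) rewrite none x = countWhere-none none xs

countWhere-concatMap-applyUpTo : ∀ {A B : Set} (p : B → Bool) (f : A → List B) (g : ℕ → A) N →
  countWhere p (concatMap f (applyUpTo g N)) ≡ sumBelow N (λ m → countWhere p (f (g m)))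
countWhere-concatMap-applyUpTo p f g zero    = refl
countWhere-concatMap-applyUpTo p f g (suc N) = begin
  countWhere p (f (g 0) ++ concatMap f (applyUpTo (g ∘ suc) N))
    ≡⟨ countWhere-++ p (f (g 0)) _ ⟩
  countWhere p (f (g 0)) + countWhere p (concatMap f (applyUpTo (g ∘ suc) N))
    ≡⟨ cong (countWhere p (f (g 0)) +_) (countWhere-concatMap-applyUpTo p f (g ∘ suc) N) ⟩
  countWhere p (f (g 0)) + sumBelow N (λ m → countWhere p (f (g (suc m))))
    ≡⟨ sym (sumBelow-unfoldˡ N _) ⟩
  sumBelow (suc N) (λ m → countWhere p (f (g m))) ∎

endsAt : ℕ × ℕ → List Step → Bool
endsAt t w = does (≡-dec _≟_ _≟_ (endpoint w) t)

endsAt-∷ : ∀ {dx dy n k} w → dx ≤ n → dy ≤ k →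
           endsAt (n , k) ((dx , dy) ∷ w) ≡ endsAt (n ∸ dx , k ∸ dy) w
endsAt-∷ {dx} {dy} {n} {k} w dx≤n dy≤k with ≡-dec _≟_ _≟_ (endpoint w) (n ∸ dx , k ∸ dy)
... | yes e = dec-true (≡-dec _≟_ _≟_ _ _)
  (cong₂ _,_ (trans (cong (dx +_) (,-injectiveˡ e)) (m+[n∸m]≡n dx≤n))
             (trans (cong (dy +_) (,-injectiveʳ e)) (m+[n∸m]≡n dy≤k)))
... | no ¬e = dec-false (≡-dec _≟_ _≟_ _ _)
  (λ e → ¬e (cong₂ _,_ (trans (sym (m+n∸m≡n dx _)) (cong (_∸ dx) (,-injectiveˡ e)))
                       (trans (sym (m+n∸m≡n dy _)) (cong (_∸ dy) (,-injectiveʳ e)))))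

endsAt-∷-overshoot : ∀ {dx dy n k} w → n < dx ⊎ k < dy → endsAt (n , k) ((dx , dy) ∷ w) ≡ false
endsAt-∷-overshoot {dx} {dy} w overshoot = dec-false (≡-dec _≟_ _≟_ _ _) reach
  where
  reach : (dx + proj₁ (endpoint w) , dy + proj₂ (endpoint w)) ≢ _
  reach e = [ (λ n<dx → <⇒≱ n<dx (subst (dx ≤_) (,-injectiveˡ e) (m≤m+n dx _)))
            , (λ k<dy → <⇒≱ k<dy (subst (dy ≤_) (,-injectiveʳ e) (m≤m+n dy _))) ]′ overshoot

endCount : List (List Step) → ℕ → Series
endCount ws k n = countWhere (endsAt (n , k)) ws

endCount-flatStep : ∀ ws k → endCount (map ((1 , 0) ∷_) ws) k ≗ shift (endCount ws k)
endCount-flatStep ws k zero    =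
  trans (countWhere-map (endsAt (0 , k)) ((1 , 0) ∷_) ws)
        (countWhere-none (λ w → endsAt-∷-overshoot {1} {0} {0} {k} w (inj₁ z<s)) ws)
endCount-flatStep ws k (suc n) =
  trans (countWhere-map (endsAt (suc n , k)) ((1 , 0) ∷_) ws)
        (countWhere-cong (λ w → endsAt-∷ {1} {0} {suc n} {k} w (s≤s z≤n) z≤n) ws)

endCount-upStep-zero : ∀ ws j n → endCount (map ((suc j , 1) ∷_) ws) 0 n ≡ 0
endCount-upStep-zero ws j n =
  trans (countWhere-map (endsAt (n , 0)) ((suc j , 1) ∷_) ws)
        (countWhere-none (λ w → endsAt-∷-overshoot {suc j} {1} {n} {0} w (inj₂ z<s)) ws)

endCount-upStep : ∀ ws j k n → endCount (map ((suc j , 1) ∷_) ws) (suc k) n ≡ shift (endCount ws k) (n ∸ j)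
endCount-upStep ws j k n with j <? n
... | yes j<n = begin
  countWhere (endsAt (n , suc k)) (map ((suc j , 1) ∷_) ws)  ≡⟨ countWhere-map (endsAt (n , suc k)) ((suc j , 1) ∷_) ws ⟩
  countWhere (endsAt (n , suc k) ∘ ((suc j , 1) ∷_)) ws      ≡⟨ countWhere-cong (λ w → endsAt-∷ {suc j} {1} {n} {suc k} w j<n (s≤s z≤n)) ws ⟩
  endCount ws k (n ∸ suc j)                                  ≡⟨ cong (shift (endCount ws k)) (sym (+-∸-assoc 1 j<n)) ⟩
  shift (endCount ws k) (n ∸ j)                              ∎
... | no j≮n = begin
  countWhere (endsAt (n , suc k)) (map ((suc j , 1) ∷_) ws)  ≡⟨ countWhere-map (endsAt (n , suc k)) ((suc j , 1) ∷_) ws ⟩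
  countWhere (endsAt (n , suc k) ∘ ((suc j , 1) ∷_)) ws      ≡⟨ countWhere-none (λ w → endsAt-∷-overshoot {suc j} {1} {n} {suc k} w (inj₁ (s≤s n≤j))) ws ⟩
  0                                                          ≡⟨ cong (shift (endCount ws k)) (sym (m≤n⇒m∸n≡0 n≤j)) ⟩
  shift (endCount ws k) (n ∸ j)                              ∎
  where n≤j = ≮⇒≥ j≮n

shift-vanish : ∀ {f : Series} {m n} → (∀ t → t < m → f t ≡ 0) → n ≤ m → shift f n ≡ 0
shift-vanish {n = zero}  _      _   = refl
shift-vanish {n = suc n} vanish n<m = vanish n n<m

module Paths (s : ℕ) where

  paths : ℕ → List (List Step)
  paths = words (steps s)

  pathCount : ℕ → ℕ → Series
  pathCount m = endCount (paths m)

  pathCount-byFirstStep : ∀ m k n → pathCount (suc m) k n ≡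
    endCount (map ((1 , 0) ∷_) (paths m)) k n
      + sumBelow s (λ j → endCount (map ((suc j , 1) ∷_) (paths m)) k n)
  pathCount-byFirstStep m k n = begin
    pathCount (suc m) k n
      ≡⟨ countWhere-++ p (extend (1 , 0)) _ ⟩
    countWhere p (extend (1 , 0)) + countWhere p (concatMap extend (map upStep (upTo s)))
      ≡⟨ cong (λ xs → countWhere p (extend (1 , 0)) + countWhere p (concatMap extend xs))
              (map-applyUpTo (λ j → j) upStep s) ⟩
    countWhere p (extend (1 , 0)) + countWhere p (concatMap extend (applyUpTo upStep s))
      ≡⟨ cong (countWhere p (extend (1 , 0)) +_) (countWhere-concatMap-applyUpTo p extend upStep s) ⟩
    countWhere p (extend (1 , 0)) + sumBelow s (λ j → countWhere p (extend (upStep j))) ∎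
    where
    p      = endsAt (n , k)
    upStep = λ j → (suc j , 1)
    extend = λ (d : Step) → map (d ∷_) (paths m)

  pathCount-suc-zero : ∀ m → pathCount (suc m) 0 ≗ shift (pathCount m 0)
  pathCount-suc-zero m n = begin
    pathCount (suc m) 0 n                    ≡⟨ pathCount-byFirstStep m 0 n ⟩
    _ + sumBelow s _                         ≡⟨ cong₂ _+_ (endCount-flatStep (paths m) 0 n)
                                                          (sumBelow-zero s (λ j → endCount-upStep-zero (paths m) j n)) ⟩
    shift (pathCount m 0) n + 0              ≡⟨ +-identityʳ _ ⟩
    shift (pathCount m 0) n                  ∎

  pathCount-suc-suc : ∀ m k n →
    pathCount (suc m) (suc k) n ≡ shift (pathCount m (suc k)) n + shiftSum s (pathCount m k) n
  pathCount-suc-suc m k n =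
    trans (pathCount-byFirstStep m (suc k) n)
          (cong₂ _+_ (endCount-flatStep (paths m) (suc k) n) (sumBelow-ext s (λ j → endCount-upStep (paths m) j k n)))

  pathCount-zero-suc : ∀ k n → pathCount 0 (suc k) n ≡ 0
  pathCount-zero-suc k zero    = refl
  pathCount-zero-suc k (suc _) = refl

  pathCount-short : ∀ m k n → n < m → pathCount m k n ≡ 0
  pathCount-short (suc m) zero n n<1+m = trans (pathCount-suc-zero m n)
    (shift-vanish (pathCount-short m 0) (≤-pred n<1+m))
  pathCount-short (suc m) (suc k) n n<1+m = begin
    pathCount (suc m) (suc k) n                                  ≡⟨ pathCount-suc-suc m k n ⟩
    shift (pathCount m (suc k)) n + shiftSum s (pathCount m k) n ≡⟨ cong₂ _+_
      (shift-vanish (pathCount-short m (suc k)) (≤-pred n<1+m))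
      (sumBelow-zero s (λ j → shift-vanish (pathCount-short m k) (≤-trans (m∸n≤m n j) (≤-pred n<1+m)))) ⟩
    0                                                            ∎

  F-byLength : ∀ {N} k n → suc n ≤ N → sumBelow N (λ m → pathCount m k n) ≡ F s k n
  F-byLength {N} k n n<N = begin
    sumBelow N (λ m → pathCount m k n)        ≡⟨ sumBelow-truncate _ n<N (λ m n<m _ → pathCount-short m k n n<m) ⟩
    sumBelow (suc n) (λ m → pathCount m k n)  ≡⟨ sym (countWhere-concatMap-applyUpTo _ paths (λ m → m) (suc n)) ⟩
    F s k n                                   ∎

  sumBelow-shift-pathCount : ∀ {N} k t → t ≤ N → sumBelow N (λ m → shift (pathCount m k) t) ≡ shift (F s k) t
  sumBelow-shift-pathCount {N} k zero    _   = sumBelow-zero N (λ _ → refl)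
  sumBelow-shift-pathCount     k (suc t) t<N = F-byLength k t t<N

  F-zero : ∀ n → F s 0 n ≡ 1
  F-zero zero    = refl
  F-zero (suc n) = begin
    F s 0 (suc n)                                           ≡⟨ sym (F-byLength 0 (suc n) ≤-refl) ⟩
    sumBelow (suc (suc n)) (λ m → pathCount m 0 (suc n))    ≡⟨ sumBelow-unfoldˡ (suc n) _ ⟩
    0 + sumBelow (suc n) (λ m → pathCount (suc m) 0 (suc n)) ≡⟨ sumBelow-ext (suc n) (λ m → pathCount-suc-zero m (suc n)) ⟩
    sumBelow (suc n) (λ m → pathCount m 0 n)                ≡⟨ F-byLength 0 n ≤-refl ⟩
    F s 0 n                                                 ≡⟨ F-zero n ⟩
    1                                                       ∎

  F-suc : ∀ k n → F s (suc k) n ≡ shift (F s (suc k)) n + shiftSum s (F s k) n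
  F-suc k n = begin
    F s (suc k) n
      ≡⟨ sym (F-byLength (suc k) n ≤-refl) ⟩
    sumBelow (suc n) (λ m → pathCount m (suc k) n)
      ≡⟨ sumBelow-unfoldˡ n _ ⟩
    pathCount 0 (suc k) n + sumBelow n (λ m → pathCount (suc m) (suc k) n)
      ≡⟨ cong₂ _+_ (pathCount-zero-suc k n) (sumBelow-ext n (λ m → pathCount-suc-suc m k n)) ⟩
    sumBelow n (λ m → shift (pathCount m (suc k)) n + shiftSum s (pathCount m k) n)
      ≡⟨ sumBelow-distrib-+ n _ _ ⟩
    sumBelow n (λ m → shift (pathCount m (suc k)) n) + sumBelow n (λ m → shiftSum s (pathCount m k) n)
      ≡⟨ cong₂ _+_ (sumBelow-shift-pathCount (suc k) n ≤-refl) (sumBelow-swap n s _) ⟩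
    shift (F s (suc k)) n + sumBelow s (λ j → sumBelow n (λ m → shift (pathCount m k) (n ∸ j)))
      ≡⟨ cong (shift (F s (suc k)) n +_)
              (sumBelow-ext s (λ j → sumBelow-shift-pathCount k (n ∸ j) (m∸n≤m n j))) ⟩
    shift (F s (suc k)) n + shiftSum s (F s k) n ∎

  F-recurrence : Recurrence s (F s)
  base F-recurrence = F-zero
  step F-recurrence = F-suc

mainTheorem2 : (s k : ℕ) → 1 ≤ s → (n : ℕ) →
    F s k n ≡ ((geomPoly s ^ˢ k) ⊛ ((X ^ˢ k) ⊛ (invOneMinusX ^ˢ suc k))) n
mainTheorem2 s k _ = recurrence-unique (Paths.F-recurrence s) (closedForm-recurrence s) k
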